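{- Let $\Sigma_r=\{0,1,-,+,\cdot\}$ (constants $0,1$, unary minus $-$, binary $+$ and $\cdot$). The term rewriting system $D_2$ obtained by orienting the following twelve equations from left to right is ground-complete: [R1] $x+0=x$; [R2$'$] $0+1=1$; [R3$'$] $x+(y+1)=(x+y)+1$; [R4] $x\cdot 0=0$; [R5] $x\cdot 1=x$; [R6$'$] $x\cdot(y+1)=(x\cdot y)+x$; [R7] $-0=0$; [R8] $(-1)+1=0$; [R9] $(-(x+1))+1=-x$; [R10] $-(-x)=x$; [R11] $x+(-y)=-((-x)+y)$; [R12] $x\cdot(-y)=-(x\cdot y)$.
   Context: Each equation is read as a rewrite rule from left to right, where $x,y$ are variables. A term rewriting system is ground-complete if it is strongly terminating (no infinite rewrite sequences) and ground-confluent (confluent on closed terms), so that every closed term has a unique normal form. -}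

module Defs where

open import Data.Empty using (⊥)
open import Data.Product using (∃; _×_)
open import Induction.WellFounded using (Acc)
open import Relation.Binary.Construct.Closure.ReflexiveTransitive using (Star)

data Term (V : Set) : Set where
  var : V → Term V
  𝟘 𝟙 : Term V
  ⊖_  : Term V → Term V
  _⊕_ : Term V → Term V → Term V
  _⊗_ : Term V → Term V → Term V

infix  8 ⊖_
infixl 7 _⊗_
infixl 6 _⊕_

Closed : Set
Closed = Term ⊥

infix 4 _⟶_
data _⟶_ {V : Set} : Term V → Term V → Set where
  R1   : ∀ x → x ⊕ 𝟘 ⟶ x
  R2′  : 𝟘 ⊕ 𝟙 ⟶ 𝟙
  R3′  : ∀ x y → x ⊕ (y ⊕ 𝟙) ⟶ (x ⊕ y) ⊕ 𝟙
  R4   : ∀ x → x ⊗ 𝟘 ⟶ 𝟘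
  R5   : ∀ x → x ⊗ 𝟙 ⟶ x
  R6′  : ∀ x y → x ⊗ (y ⊕ 𝟙) ⟶ (x ⊗ y) ⊕ x
  R7   : ⊖ 𝟘 ⟶ 𝟘
  R8   : (⊖ 𝟙) ⊕ 𝟙 ⟶ 𝟘
  R9   : ∀ x → (⊖ (x ⊕ 𝟙)) ⊕ 𝟙 ⟶ ⊖ x
  R10  : ∀ x → ⊖ (⊖ x) ⟶ x
  R11  : ∀ x y → x ⊕ (⊖ y) ⟶ ⊖ ((⊖ x) ⊕ y)
  R12  : ∀ x y → x ⊗ (⊖ y) ⟶ ⊖ (x ⊗ y)
  ctx-⊖  : ∀ {s t} → s ⟶ t → ⊖ s ⟶ ⊖ t
  ctx-⊕ˡ : ∀ {s t} u → s ⟶ t → s ⊕ u ⟶ t ⊕ u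
  ctx-⊕ʳ : ∀ {s t} u → s ⟶ t → u ⊕ s ⟶ u ⊕ t
  ctx-⊗ˡ : ∀ {s t} u → s ⟶ t → s ⊗ u ⟶ t ⊗ u
  ctx-⊗ʳ : ∀ {s t} u → s ⟶ t → u ⊗ s ⟶ u ⊗ t

infix 4 _⟶*_
_⟶*_ : {V : Set} → Term V → Term V → Set
_⟶*_ = Star _⟶_

_⟵_ : {V : Set} → Term V → Term V → Set
t ⟵ s = s ⟶ t

-- Strongly terminating: no infinite rewrite sequence from any (open) term,
-- stated constructively as accessibility of every term.
StronglyTerminating : Set₁
StronglyTerminating = ∀ (V : Set) (t : Term V) → Acc (_⟵_ {V}) t

GroundConfluent : Set
GroundConfluent = ∀ (t a b : Closed) → t ⟶* a → t ⟶* b →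
  ∃ λ c → (a ⟶* c) × (b ⟶* c)

GroundComplete : Set₁
GroundComplete = StronglyTerminating × GroundConfluent

-- Termination: the polynomial interpretation 𝟘 = 0, 𝟙 = 1, ⊖ a = a + 1,
-- a ⊕ b = a + 3b + 1, a ⊗ b = (a + 1)(2b + 1) (variables = 0) is strictly
-- monotone in every argument and strictly decreases along every rule.
-- Ground confluence: every closed term in normal form is a numeral 𝟘, 1 ⊕ ⋯ ⊕ 1
-- or ⊖ (1 ⊕ ⋯ ⊕ 1), and evaluation in ℤ is invariant under rewriting and
-- injective on numerals; so two reducts of a closed term normalise to the
-- same numeral.
module Submission where

open import Defs
open import Data.Empty using (⊥)
open import Data.Sum using (_⊎_; inj₁; inj₂)
open import Data.Product using (∃; _×_; _,_)
open import Data.Nat using (ℕ; zero; suc; _+_; _*_; _<_; z<s; s<s)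
open import Data.Nat.Properties using (m<m+n; +-comm; +-monoˡ-<; +-monoʳ-<; *-monoˡ-<; *-monoʳ-<)
open import Data.Nat.Induction using (<-wellFounded)
open import Data.Nat.Tactic.RingSolver using (solve-∀)
open import Data.Integer using (ℤ; +_; -[1+_]) renaming (_+_ to _+ℤ_; _*_ to _*ℤ_; -_ to -ℤ_)
open import Data.Integer.Properties using (+-identityʳ; +-assoc; *-zeroʳ; *-identityʳ; *-distribˡ-+; neg-involutive; neg-distribʳ-*)
import Data.Integer.Tactic.RingSolver as ℤ-Solver
open import Function using (flip; _on_)
open import Induction.WellFounded using (Acc; acc; module Subrelation)
import Relation.Binary.Construct.On as On
open import Relation.Binary.PropositionalEquality using (_≡_; refl; sym; trans; cong; subst; module ≡-Reasoning)
open import Relation.Binary.Construct.Closure.ReflexiveTransitive using (Star; ε; _◅_; fold)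

weight : {V : Set} → Term V → ℕ
weight (var _) = 0
weight 𝟘       = 0
weight 𝟙       = 1
weight (⊖ x)   = suc (weight x)
weight (x ⊕ y) = suc (weight x + 3 * weight y)
weight (x ⊗ y) = suc (weight x) * suc (2 * weight y)

m≡n+1+k⇒n<m : ∀ {m n} k → m ≡ n + suc k → n < m
m≡n+1+k⇒n<m {n = n} k refl = m<m+n n z<s

weight-decreases : {V : Set} {s t : Term V} → s ⟶ t → weight t < weight s
weight-decreases (R1 x) = m≡n+1+k⇒n<m 0 (eq (weight x))
  where eq : ∀ a → suc (a + 3 * 0) ≡ a + 1
        eq = solve-∀
weight-decreases R2′ = m≡n+1+k⇒n<m 2 refl
weight-decreases (R3′ x y) = m≡n+1+k⇒n<m 7 (eq (weight x) (weight y))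
  where eq : ∀ a b → suc (a + 3 * suc (b + 3)) ≡ suc (suc (a + 3 * b) + 3) + 8
        eq = solve-∀
weight-decreases (R4 x) = m≡n+1+k⇒n<m (weight x) (eq (weight x))
  where eq : ∀ a → suc a * suc (2 * 0) ≡ 0 + suc a
        eq = solve-∀
weight-decreases (R5 x) = m≡n+1+k⇒n<m (2 * weight x + 2) (eq (weight x))
  where eq : ∀ a → suc a * suc (2 * 1) ≡ a + suc (2 * a + 2)
        eq = solve-∀
weight-decreases (R6′ x y) = m≡n+1+k⇒n<m (5 * weight x + 6) (eq (weight x) (weight y))
  where eq : ∀ a b → suc a * suc (2 * suc (b + 3))
                     ≡ suc (suc a * suc (2 * b) + 3 * a) + suc (5 * a + 6)
        eq = solve-∀
weight-decreases R7 = m≡n+1+k⇒n<m 0 refl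
weight-decreases R8 = m≡n+1+k⇒n<m 5 refl
weight-decreases (R9 x) = m≡n+1+k⇒n<m 7 (eq (weight x))
  where eq : ∀ a → suc (suc (suc (a + 3)) + 3) ≡ suc a + 8
        eq = solve-∀
weight-decreases (R10 x) = m≡n+1+k⇒n<m 1 (eq (weight x))
  where eq : ∀ a → suc (suc a) ≡ a + 2
        eq = solve-∀
weight-decreases (R11 x y) = m≡n+1+k⇒n<m 0 (eq (weight x) (weight y))
  where eq : ∀ a b → suc (a + 3 * suc b) ≡ suc (suc (suc a) + 3 * b) + 1
        eq = solve-∀
weight-decreases (R12 x y) = m≡n+1+k⇒n<m (2 * weight x) (eq (weight x) (weight y))
  where eq : ∀ a b → suc a * suc (2 * suc b) ≡ suc (suc a * suc (2 * b)) + suc (2 * a)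
        eq = solve-∀
weight-decreases (ctx-⊖ s⟶t) = s<s (weight-decreases s⟶t)
weight-decreases (ctx-⊕ˡ u s⟶t) =
  s<s (+-monoˡ-< (3 * weight u) (weight-decreases s⟶t))
weight-decreases (ctx-⊕ʳ u s⟶t) =
  s<s (+-monoʳ-< (weight u) (*-monoʳ-< 3 (weight-decreases s⟶t)))
weight-decreases (ctx-⊗ˡ u s⟶t) =
  *-monoˡ-< (suc (2 * weight u)) (s<s (weight-decreases s⟶t))
weight-decreases (ctx-⊗ʳ u s⟶t) =
  *-monoʳ-< (suc (weight u)) (s<s (*-monoʳ-< 2 (weight-decreases s⟶t)))

⟶-stronglyTerminating : StronglyTerminating
⟶-stronglyTerminating V =
  Subrelation.wellFounded weight-decreases (On.wellFounded weight <-wellFounded)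

progress⇒reaches : {A : Set} {_⇒_ : A → A → Set} {P : A → Set} →
                   (∀ x → P x ⊎ ∃ (x ⇒_)) →
                   ∀ {x} → Acc (flip _⇒_) x → ∃ λ y → Star _⇒_ x y × P y
progress⇒reaches progress {x} (acc rs) with progress x
... | inj₁ Px = x , ε , Px
... | inj₂ (x′ , x⇒x′) with progress⇒reaches progress (rs x⇒x′)
...   | y , x′⇒*y , Py = y , x⇒x′ ◅ x′⇒*y , Py

-- positive n is the numeral for 1 + n.
positive : ℕ → Closed
positive zero    = 𝟙
positive (suc n) = positive n ⊕ 𝟙

⌜_⌝ : ℤ → Closed
⌜ + zero ⌝    = 𝟘
⌜ + suc n ⌝   = positive n
⌜ -[1+ n ] ⌝  = ⊖ positive n

data Numeral : Closed → Set where
  numeral : ∀ z → Numeral ⌜ z ⌝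

numeral-or-reducible : (t : Closed) → Numeral t ⊎ ∃ (t ⟶_)
numeral-or-reducible (var ())
numeral-or-reducible 𝟘 = inj₁ (numeral (+ 0))
numeral-or-reducible 𝟙 = inj₁ (numeral (+ 1))
numeral-or-reducible (⊖ s) with numeral-or-reducible s
... | inj₂ (_ , s⟶s′)              = inj₂ (_ , ctx-⊖ s⟶s′)
... | inj₁ (numeral (+ zero))      = inj₂ (_ , R7)
... | inj₁ (numeral (+ suc n))     = inj₁ (numeral -[1+ n ])
... | inj₁ (numeral -[1+ n ])      = inj₂ (_ , R10 (positive n))
numeral-or-reducible (s ⊕ u) with numeral-or-reducible s | numeral-or-reducible u
... | inj₂ (_ , s⟶s′) | _                       = inj₂ (_ , ctx-⊕ˡ u s⟶s′)
... | inj₁ _ | inj₂ (_ , u⟶u′)                  = inj₂ (_ , ctx-⊕ʳ s u⟶u′)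
... | inj₁ _ | inj₁ (numeral (+ zero))          = inj₂ (_ , R1 s)
... | inj₁ _ | inj₁ (numeral (+ suc (suc n)))   = inj₂ (_ , R3′ s (positive n))
... | inj₁ _ | inj₁ (numeral -[1+ n ])          = inj₂ (_ , R11 s (positive n))
... | inj₁ (numeral (+ zero)) | inj₁ (numeral (+ 1))       = inj₂ (_ , R2′)
... | inj₁ (numeral (+ suc n)) | inj₁ (numeral (+ 1))      = inj₁ (numeral (+ suc (suc n)))
... | inj₁ (numeral -[1+ zero ]) | inj₁ (numeral (+ 1))    = inj₂ (_ , R8)
... | inj₁ (numeral -[1+ suc n ]) | inj₁ (numeral (+ 1))   = inj₂ (_ , R9 (positive n))
numeral-or-reducible (s ⊗ u) with numeral-or-reducible u
... | inj₂ (_ , u⟶u′)                 = inj₂ (_ , ctx-⊗ʳ s u⟶u′)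
... | inj₁ (numeral (+ zero))         = inj₂ (_ , R4 s)
... | inj₁ (numeral (+ 1))            = inj₂ (_ , R5 s)
... | inj₁ (numeral (+ suc (suc n)))  = inj₂ (_ , R6′ s (positive n))
... | inj₁ (numeral -[1+ n ])         = inj₂ (_ , R12 s (positive n))

normalise : (t : Closed) → ∃ λ n → t ⟶* n × Numeral n
normalise t = progress⇒reaches numeral-or-reducible (⟶-stronglyTerminating ⊥ t)

⟦_⟧ : Closed → ℤ
⟦ var () ⟧
⟦ 𝟘 ⟧     = + 0
⟦ 𝟙 ⟧     = + 1
⟦ ⊖ x ⟧   = -ℤ ⟦ x ⟧
⟦ x ⊕ y ⟧ = ⟦ x ⟧ +ℤ ⟦ y ⟧
⟦ x ⊗ y ⟧ = ⟦ x ⟧ *ℤ ⟦ y ⟧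

⟶-preserves-⟦⟧ : {s t : Closed} → s ⟶ t → ⟦ s ⟧ ≡ ⟦ t ⟧
⟶-preserves-⟦⟧ (R1 x)      = +-identityʳ ⟦ x ⟧
⟶-preserves-⟦⟧ R2′         = refl
⟶-preserves-⟦⟧ (R3′ x y)   = sym (+-assoc ⟦ x ⟧ ⟦ y ⟧ (+ 1))
⟶-preserves-⟦⟧ (R4 x)      = *-zeroʳ ⟦ x ⟧
⟶-preserves-⟦⟧ (R5 x)      = *-identityʳ ⟦ x ⟧
⟶-preserves-⟦⟧ (R6′ x y)   =
  trans (*-distribˡ-+ ⟦ x ⟧ ⟦ y ⟧ (+ 1)) (cong (⟦ x ⟧ *ℤ ⟦ y ⟧ +ℤ_) (*-identityʳ ⟦ x ⟧))
⟶-preserves-⟦⟧ R7          = refl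
⟶-preserves-⟦⟧ R8          = refl
⟶-preserves-⟦⟧ (R9 x)      = eq ⟦ x ⟧
  where eq : ∀ a → -ℤ (a +ℤ + 1) +ℤ + 1 ≡ -ℤ a
        eq = ℤ-Solver.solve-∀
⟶-preserves-⟦⟧ (R10 x)     = neg-involutive ⟦ x ⟧
⟶-preserves-⟦⟧ (R11 x y)   = eq ⟦ x ⟧ ⟦ y ⟧
  where eq : ∀ a b → a +ℤ -ℤ b ≡ -ℤ (-ℤ a +ℤ b)
        eq = ℤ-Solver.solve-∀
⟶-preserves-⟦⟧ (R12 x y)   = sym (neg-distribʳ-* ⟦ x ⟧ ⟦ y ⟧)
⟶-preserves-⟦⟧ (ctx-⊖ s⟶t)    = cong -ℤ_ (⟶-preserves-⟦⟧ s⟶t)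
⟶-preserves-⟦⟧ (ctx-⊕ˡ u s⟶t) = cong (_+ℤ ⟦ u ⟧) (⟶-preserves-⟦⟧ s⟶t)
⟶-preserves-⟦⟧ (ctx-⊕ʳ u s⟶t) = cong (⟦ u ⟧ +ℤ_) (⟶-preserves-⟦⟧ s⟶t)
⟶-preserves-⟦⟧ (ctx-⊗ˡ u s⟶t) = cong (_*ℤ ⟦ u ⟧) (⟶-preserves-⟦⟧ s⟶t)
⟶-preserves-⟦⟧ (ctx-⊗ʳ u s⟶t) = cong (⟦ u ⟧ *ℤ_) (⟶-preserves-⟦⟧ s⟶t)

⟶*-preserves-⟦⟧ : {s t : Closed} → s ⟶* t → ⟦ s ⟧ ≡ ⟦ t ⟧
⟶*-preserves-⟦⟧ = fold (_≡_ on ⟦_⟧) (λ s⟶t → trans (⟶-preserves-⟦⟧ s⟶t)) refl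

⟦positive⟧ : ∀ n → ⟦ positive n ⟧ ≡ + suc n
⟦positive⟧ zero    = refl
⟦positive⟧ (suc n) = trans (cong (_+ℤ + 1) (⟦positive⟧ n)) (cong +_ (+-comm (suc n) 1))

⟦⌜⌝⟧ : ∀ z → ⟦ ⌜ z ⌝ ⟧ ≡ z
⟦⌜⌝⟧ (+ zero)   = refl
⟦⌜⌝⟧ (+ suc n)  = ⟦positive⟧ n
⟦⌜⌝⟧ -[1+ n ]   = cong -ℤ_ (⟦positive⟧ n)

⟦⟧-injective-on-Numeral : ∀ {m n} → Numeral m → Numeral n → ⟦ m ⟧ ≡ ⟦ n ⟧ → m ≡ n
⟦⟧-injective-on-Numeral (numeral z) (numeral z′) ⟦z⟧≡⟦z′⟧ =
  cong ⌜_⌝ (trans (sym (⟦⌜⌝⟧ z)) (trans ⟦z⟧≡⟦z′⟧ (⟦⌜⌝⟧ z′)))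

⟶-groundConfluent : GroundConfluent
⟶-groundConfluent t a b t⟶*a t⟶*b with normalise a | normalise b
... | m , a⟶*m , numeral-m | n , b⟶*n , numeral-n =
  m , a⟶*m , subst (b ⟶*_) (sym m≡n) b⟶*n
  where
  open ≡-Reasoning
  m≡n : m ≡ n
  m≡n = ⟦⟧-injective-on-Numeral numeral-m numeral-n (begin
    ⟦ m ⟧ ≡⟨ ⟶*-preserves-⟦⟧ a⟶*m ⟨
    ⟦ a ⟧ ≡⟨ ⟶*-preserves-⟦⟧ t⟶*a ⟨
    ⟦ t ⟧ ≡⟨ ⟶*-preserves-⟦⟧ t⟶*b ⟩
    ⟦ b ⟧ ≡⟨ ⟶*-preserves-⟦⟧ b⟶*n ⟩
    ⟦ n ⟧ ∎)

theorem2p2p1 : GroundComplete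
theorem2p2p1 = ⟶-stronglyTerminating , ⟶-groundConfluent
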